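{- For every natural number $n>1$ there exists a (finite, simple, connected) graph $G$ with $d_\Delta(G)=n$.
   Context: For a graph $G=(V,E)$ and $S\subseteq V$, the $\Delta$-interval $[S]$ is the set consisting of all vertices of $S$ together with every vertex $v\in V$ adjacent to both $x$ and $y$ for some pair of adjacent vertices $x,y\in S$. A set $S$ is $\Delta$-convex if $[S]=S$, and $\langle S\rangle$ denotes the smallest $\Delta$-convex set containing $S$ ($\langle\emptyset\rangle=\emptyset$). A set $S$ is convexly independent if $a\notin\langle S\setminus\{a\}\rangle$ for every $a\in S$. The rank $d_\Delta(G)$ is the least integer $n\ge0$ such that every $S\subseteq V$ with $|S|>n$ is not convexly independent (equivalently, the maximum size of a convexly independent set). -}

module Defs where

open import Data.Nat using (ℕ; _<_; _>_)
open import Data.Bool using (Bool; true; false)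
open import Data.Fin using (Fin)
open import Data.Fin.Subset using (Subset; _∈_; _∉_; _⊆_; _-_; ∣_∣)
open import Data.Product using (Σ; ∃; ∃-syntax; _×_; _,_)
open import Data.Sum using (_⊎_)
open import Relation.Nullary using (¬_)
open import Relation.Binary.PropositionalEquality using (_≡_)
open import Relation.Binary.Construct.Closure.ReflexiveTransitive using (Star)

record Graph (m : ℕ) : Set where
  field
    adj   : Fin m → Fin m → Bool
    sym   : ∀ x y → adj x y ≡ adj y x
    irrefl : ∀ x → adj x x ≡ false

module _ {m : ℕ} (G : Graph m) where
  open Graph G

  Adj : Fin m → Fin m → Set
  Adj x y = adj x y ≡ true

  Connected : Set
  Connected = ∀ u v → Star Adj u v

  -- v ∈ [S], the Δ-interval of S
  InInterval : Subset m → Fin m → Set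
  InInterval S v =
    v ∈ S ⊎ (∃[ x ] ∃[ y ] (x ∈ S × y ∈ S × Adj x y × Adj v x × Adj v y))

  -- S is Δ-convex: [S] = S  (S ⊆ [S] always holds)
  ΔConvex : Subset m → Set
  ΔConvex S = ∀ v → InInterval S v → v ∈ S

  -- v ∈ ⟨S⟩: v lies in every Δ-convex set containing S
  -- (⟨S⟩ is the smallest Δ-convex superset of S; ⟨∅⟩ = ∅ automatically,
  --  since ∅ is Δ-convex)
  InHull : Subset m → Fin m → Set
  InHull S v = ∀ T → S ⊆ T → ΔConvex T → v ∈ T

  ConvexlyIndependent : Subset m → Set
  ConvexlyIndependent S = ∀ a → a ∈ S → ¬ InHull (S - a) a

  RankBound : ℕ → Set
  RankBound n = ∀ S → ∣ S ∣ > n → ¬ ConvexlyIndependent S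

  -- d_Δ(G) = n : n is the least integer with RankBound
  HasRank : ℕ → Set
  HasRank n = RankBound n × (∀ k → k < n → ¬ RankBound k)

-- In a triangle-free graph no vertex has two adjacent neighbours, so every
-- Δ-interval [S] is S itself: every vertex set is Δ-convex, hence every set
-- is convexly independent, and the rank is the number of vertices. The star
-- K₁,ₙ₋₁ is connected, triangle-free and has n vertices.
module Submission where

open import Defs
open import Data.Nat using (ℕ; suc; _<_)
open import Data.Nat.Properties using (<⇒≱)
open import Data.Bool using (Bool; true; false)
open import Data.Empty using (⊥; ⊥-elim)
open import Data.Fin using (Fin; zero; suc)
open import Data.Fin.Subset using (Subset; _∉_; _-_; ⊤)
open import Data.Fin.Subset.Properties using (∣p∣≤n; ∣⊤∣≡n)
open import Data.Vec.Base using (_∷_; _[_]=_)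
open _[_]=_ using (there)
open import Data.Product using (Σ; _×_; _,_)
open import Data.Sum using (inj₁; inj₂)
open import Function using (id)
open import Relation.Nullary using (¬_)
open import Relation.Binary.PropositionalEquality using (_≡_; refl; sym; subst)
open import Relation.Binary.Construct.Closure.ReflexiveTransitive using (Star; ε; _◅_; _◅◅_)

x∉p-x : ∀ {n} (p : Subset n) (x : Fin n) → x ∉ p - x
x∉p-x (_ ∷ p) zero    ()
x∉p-x (_ ∷ p) (suc x) (there x∈p-x) = x∉p-x p x x∈p-x

module _ {m : ℕ} (G : Graph m) where

  TriangleFree : Set
  TriangleFree = ∀ x y v → Adj G x y → Adj G v x → Adj G v y → ⊥

  triangleFree⇒ΔConvex : TriangleFree → ∀ T → ΔConvex G T
  triangleFree⇒ΔConvex _    T v (inj₁ v∈T) = v∈T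
  triangleFree⇒ΔConvex free T v (inj₂ (x , y , _ , _ , xy , vx , vy)) =
    ⊥-elim (free x y v xy vx vy)

  triangleFree⇒ConvexlyIndependent : TriangleFree → ∀ S → ConvexlyIndependent G S
  triangleFree⇒ConvexlyIndependent free S a _ a∈⟨S-a⟩ =
    x∉p-x S a (a∈⟨S-a⟩ (S - a) id (triangleFree⇒ΔConvex free (S - a)))

  rankBound-order : RankBound G m
  rankBound-order S ∣S∣>m _ = <⇒≱ ∣S∣>m (∣p∣≤n S)

  triangleFree⇒HasRank-order : TriangleFree → HasRank G m
  triangleFree⇒HasRank-order free = rankBound-order , not-bound
    where
    not-bound : ∀ k → k < m → ¬ RankBound G k
    not-bound k k<m bound =
      bound ⊤ (subst (k <_) (sym (∣⊤∣≡n m)) k<m)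
              (triangleFree⇒ConvexlyIndependent free ⊤)

starAdj : ∀ {m} → Fin m → Fin m → Bool
starAdj zero    zero    = false
starAdj zero    (suc _) = true
starAdj (suc _) zero    = true
starAdj (suc _) (suc _) = false

starAdj-sym : ∀ {m} (x y : Fin m) → starAdj x y ≡ starAdj y x
starAdj-sym zero    zero    = refl
starAdj-sym zero    (suc _) = refl
starAdj-sym (suc _) zero    = refl
starAdj-sym (suc _) (suc _) = refl

starAdj-irrefl : ∀ {m} (x : Fin m) → starAdj x x ≡ false
starAdj-irrefl zero    = refl
starAdj-irrefl (suc _) = refl

-- The vertex zero is the centre; for m = 0 this is the empty graph.
star : (m : ℕ) → Graph m
star m = record { adj = starAdj ; sym = starAdj-sym ; irrefl = starAdj-irrefl }

star-triangleFree : ∀ m → TriangleFree (star m)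
star-triangleFree m zero    zero    _       ()
star-triangleFree m zero    (suc _) zero    _  ()
star-triangleFree m zero    (suc _) (suc _) _  _  ()
star-triangleFree m (suc _) zero    zero    _  _  ()
star-triangleFree m (suc _) zero    (suc _) _  ()
star-triangleFree m (suc _) (suc _) _       ()

star-connected : ∀ m → Connected (star m)
star-connected (suc m) u v = toCentre u ◅◅ fromCentre v
  where
  toCentre : ∀ u → Star (Adj (star (suc m))) u zero
  toCentre zero    = ε
  toCentre (suc _) = refl ◅ ε

  fromCentre : ∀ v → Star (Adj (star (suc m))) zero v
  fromCentre zero    = ε
  fromCentre (suc _) = refl ◅ ε

proposition3 : (n : ℕ) → 1 < n →
    Σ ℕ (λ m → Σ (Graph m) (λ G → Connected G × HasRank G n))
proposition3 n _ =
  n , star n , star-connected n , triangleFree⇒HasRank-order (star n) (star-triangleFree n)
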